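{- Let $t\in\mathbf{PBT}_n$ be such that $t=\mathbf 1_r\,\underline{\circ}\,(t_1,\dots,t_{r-1},\vert)$ with $r<n$ and $t_j\in\mathbf{PBT}_{n_j}$ for $1\le j<r$. Then $M_t=M_{\mathbf 1_r}\,\underline{\circ}\,(M_{t_1},\dots,M_{t_{r-1}},\vert)$.
   Context: Planar binary rooted trees: every internal vertex has two children; $\mathbf{PBT}_n$ = such trees with $n$ leaves (numbered left to right), $\mathbf{PBT}_1=\{\vert\}$. $t\veebar w$ joins the roots of $t$ (left) and $w$ (right) to a new root. $t\circ_j w$ identifies the root of $w$ with the $j$-th leaf of $t$; for $t$ with $r$ leaves, $t\,\underline{\circ}\,(w_1,\dots,w_r)=(((t\circ_r w_r)\circ_{r-1}w_{r-1})\cdots)\circ_1 w_1$; extended multilinearly. $\mathbf 1_1=\vert$, $\mathbf 1_r=\vert\veebar\mathbf 1_{r-1}$. Tamari order $\le_T$ on $\mathbf{PBT}_n$: generated by $(t_1\veebar t_2)\veebar t_3\le_T t_1\veebar(t_2\veebar t_3)$ and compatibility of $\veebar$ with $\le_T$ in each argument. $M_t:=\sum_{w\le_T t}\mu(w,t)w$, $\mu$ the Möbius function of $\le_T$. -}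

module Defs where

open import Data.Nat as ℕ using (ℕ; zero; suc; _∸_; _≤ᵇ_)
open import Data.Integer using (ℤ; 0ℤ; 1ℤ; _+_; _*_)
open import Data.Bool using (if_then_else_)
open import Data.List using (List; []; _∷_; map; concatMap; foldr)
open import Data.Product using (_×_; _,_)
open import Data.List.Membership.Propositional using (_∈_)
open import Data.List.Relation.Unary.Unique.Propositional using (Unique)
open import Relation.Binary.PropositionalEquality using (_≡_; refl; cong₂)
open import Relation.Nullary using (¬_; yes; no; Dec)
open import Relation.Nullary.Decidable using (map′)
open import Function.Bundles using (_⇔_)

-- Planar binary rooted trees.  PBT_n = trees t with leaves t ≡ n.

data Tree : Set where
  leaf : Tree
  _∨_  : Tree → Tree → Tree

infixr 6 _∨_

leaves : Tree → ℕ
leaves leaf    = 1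
leaves (a ∨ b) = leaves a ℕ.+ leaves b

∨-injˡ : ∀ {a b c d} → (a ∨ b) ≡ (c ∨ d) → a ≡ c
∨-injˡ refl = refl

∨-injʳ : ∀ {a b c d} → (a ∨ b) ≡ (c ∨ d) → b ≡ d
∨-injʳ refl = refl

_≟T_ : (s t : Tree) → Dec (s ≡ t)
leaf    ≟T leaf    = yes refl
leaf    ≟T (_ ∨ _) = no λ ()
(_ ∨ _) ≟T leaf    = no λ ()
(a ∨ b) ≟T (c ∨ d) with a ≟T c | b ≟T d
... | yes p | yes q = yes (cong₂ _∨_ p q)
... | no ¬p | _     = no λ e → ¬p (∨-injˡ e)
... | yes _ | no ¬q = no λ e → ¬q (∨-injʳ e)

-- 1_1 = | ,  1_r = | ∨ 1_{r-1}   (1_0 is not used; set to | )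
𝟏 : ℕ → Tree
𝟏 zero            = leaf
𝟏 (suc zero)      = leaf
𝟏 (suc (suc k))   = leaf ∨ 𝟏 (suc k)

-- Grafting.  graft t j w = t ∘_j w : root of w identified with the
-- j-th leaf of t (leaves numbered 1,2,… from left to right).

graft : Tree → ℕ → Tree → Tree
graft leaf    (suc zero) w = w
graft leaf    _          w = leaf     -- j out of range: unused
graft (a ∨ b) j          w =
  if j ≤ᵇ leaves a then graft a j w ∨ b
                   else a ∨ graft b (j ∸ leaves a) w

graftFrom : Tree → ℕ → List Tree → Tree
graftFrom t j []       = t
graftFrom t j (w ∷ ws) = graft (graftFrom t (suc j) ws) j w

-- t ∘ (w_1,…,w_r) = (((t ∘_r w_r) ∘_{r-1} w_{r-1}) ⋯) ∘_1 w_1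
_⊚_ : Tree → List Tree → Tree
t ⊚ ws = graftFrom t 1 ws

data _≤T_ : Tree → Tree → Set where
  ≤T-refl  : ∀ {t} → t ≤T t
  ≤T-trans : ∀ {s t u} → s ≤T t → t ≤T u → s ≤T u
  ≤T-rot   : ∀ {a b c} → ((a ∨ b) ∨ c) ≤T (a ∨ (b ∨ c))
  ≤T-∨ˡ    : ∀ {a a′ b} → a ≤T a′ → (a ∨ b) ≤T (a′ ∨ b)
  ≤T-∨ʳ    : ∀ {a b b′} → b ≤T b′ → (a ∨ b) ≤T (a ∨ b′)

-- Integer linear combinations of trees (elements of the free ℤ-module on
-- trees), as formal lists; equality is equality of all coefficients.

LC : Set
LC = List (ℤ × Tree)

coeff : LC → Tree → ℤ
coeff []            s = 0ℤ
coeff ((c , t) ∷ f) s with t ≟T s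
... | yes _ = c + coeff f s
... | no  _ = coeff f s

_≈_ : LC → LC → Set
f ≈ g = ∀ s → coeff f s ≡ coeff g s

infix 4 _≈_

basis : Tree → LC
basis t = (1ℤ , t) ∷ []

choices : List LC → List (ℤ × List Tree)
choices []       = (1ℤ , []) ∷ []
choices (g ∷ gs) =
  concatMap (λ { (c , w) → map (λ { (d , ws) → (c * d , w ∷ ws) }) (choices gs) }) g

-- multilinear extension of t ∘ (w_1,…,w_r)
_⊚ᴸ_ : LC → List LC → LC
f ⊚ᴸ gs =
  concatMap (λ { (c , t) → map (λ { (d , ws) → (c * d , t ⊚ ws) }) (choices gs) }) f

-- Möbius function of the Tamari order, together with the (finite)
-- lower sets {w | w ≤T t}.  μ is characterised by the defining recursion
--   μ(x,y) = 0 unless x ≤T y,   Σ_{x ≤T z ≤T y} μ(x,z) = δ(x,y);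
-- since μ(x,z) = 0 unless x ≤T z, the second condition is the sum of
-- μ(x,z) over the lower set of y.  Such data exist and μ is unique.

sumℤ : List ℤ → ℤ
sumℤ = foldr _+_ 0ℤ

δ : Tree → Tree → ℤ
δ x y with x ≟T y
... | yes _ = 1ℤ
... | no  _ = 0ℤ

record TamariMöbius : Set where
  field
    down          : Tree → List Tree
    down-unique   : ∀ t → Unique (down t)
    down-complete : ∀ t w → (w ∈ down t) ⇔ (w ≤T t)
    μ             : Tree → Tree → ℤ
    μ-zero        : ∀ x y → ¬ (x ≤T y) → μ x y ≡ 0ℤ
    μ-sum         : ∀ x y → sumℤ (map (μ x) (down y)) ≡ δ x y

  M : Tree → LC
  M t = map (λ w → (μ w t , w)) (down t)

-- The Tamari order is the componentwise order on bracket vectors.  With this, inclusion–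
-- exclusion over sets of edges rotated simultaneously shows that μ(s, t) = (-1)^k when s
-- arises from t by rotating k of its edges at once, and μ(s, t) = 0 otherwise; so M_t is the
-- signed sum of these rotations of t.  The edges of t = t₁ ∨ (t₂ ∨ ⋯ (t_{r-1} ∨ |)) are those
-- of the comb 𝟏_r together with those of the t_j, and rotating commutes with grafting the t_j
-- onto the leaves of 𝟏_r, so the signed sum for t is the grafting of those for 𝟏_r and the t_j.

module Submission where

open import Defs
open import Data.Nat as ℕ using (ℕ; zero; suc; _<_; _≤_; z≤n; s≤s; _≤ᵇ_; _∸_)
import Data.Nat.Properties as ℕ
open import Data.Integer using (ℤ; 0ℤ; 1ℤ; -1ℤ; _+_; _*_)
import Data.Integer.Properties as ℤ
open import Data.Integer.Tactic.RingSolver using (solve-∀)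
open import Algebra.Properties.CommutativeSemigroup ℤ.+-commutativeSemigroup using ()
  renaming (interchange to +-interchange)
open import Algebra.Properties.CommutativeSemigroup ℤ.*-commutativeSemigroup using ()
  renaming (interchange to *-interchange)
open import Data.Bool using (Bool; true; false; _∧_; not; if_then_else_)
import Data.Bool.Properties as Bool
open import Data.List using (List; []; _∷_; length; map; _++_; concatMap; take; drop; deduplicate)
import Data.List.Properties as List
open import Data.List.Membership.Propositional using (_∈_; _∉_)
open import Data.List.Membership.Propositional.Properties using (∈-map⁺; ∈-map⁻; ∈-++⁺ˡ; ∈-++⁺ʳ; ∈-deduplicate⁺)
open import Data.List.Relation.Unary.Any using (here; there)
import Data.List.Relation.Unary.All as All
open import Data.List.Relation.Unary.Unique.Propositional using (Unique)
open import Data.List.Relation.Unary.AllPairs using (_∷_)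
import Data.List.Relation.Unary.Unique.DecPropositional.Properties as Unique
open import Data.List.Relation.Binary.Pointwise as Pointwise using (Pointwise; []; _∷_)
open import Data.Product using (∃-syntax; _×_; _,_; proj₁; proj₂)
open import Data.Sum using (_⊎_; inj₁; inj₂)
open import Data.Unit using (⊤; tt)
open import Data.Empty using (⊥-elim)
open import Function using (_∘_)
open import Function.Bundles using (Equivalence)
open import Relation.Binary.PropositionalEquality
open import Relation.Nullary using (¬_; yes; no)
open ≡-Reasoning

private variable A B : Set

∑ : List A → (A → ℤ) → ℤ
∑ xs f = sumℤ (map f xs)

syntax ∑ xs (λ x → e) = ∑[ x ∈ xs ] e

∑-cong-∈ : (xs : List A) {f g : A → ℤ} → (∀ {x} → x ∈ xs → f x ≡ g x) → ∑ xs f ≡ ∑ xs g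
∑-cong-∈ []       e = refl
∑-cong-∈ (x ∷ xs) e = cong₂ _+_ (e (here refl)) (∑-cong-∈ xs (e ∘ there))

∑-cong : (xs : List A) {f g : A → ℤ} → (∀ x → f x ≡ g x) → ∑ xs f ≡ ∑ xs g
∑-cong xs e = ∑-cong-∈ xs (λ {x} _ → e x)

∑-zero : (xs : List A) → ∑[ x ∈ xs ] 0ℤ ≡ 0ℤ
∑-zero []       = refl
∑-zero (x ∷ xs) = trans (ℤ.+-identityˡ _) (∑-zero xs)

∑-+ : (xs : List A) (f g : A → ℤ) → ∑[ x ∈ xs ] (f x + g x) ≡ ∑ xs f + ∑ xs g
∑-+ []       f g = refl
∑-+ (x ∷ xs) f g = begin
  (f x + g x) + ∑[ x ∈ xs ] (f x + g x) ≡⟨ cong ((f x + g x) +_) (∑-+ xs f g) ⟩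
  (f x + g x) + (∑ xs f + ∑ xs g)       ≡⟨ +-interchange (f x) (g x) _ _ ⟩
  (f x + ∑ xs f) + (g x + ∑ xs g)       ∎

∑-*ˡ : (xs : List A) (c : ℤ) (f : A → ℤ) → ∑[ x ∈ xs ] (c * f x) ≡ c * ∑ xs f
∑-*ˡ []       c f = sym (ℤ.*-zeroʳ c)
∑-*ˡ (x ∷ xs) c f = trans (cong (c * f x +_) (∑-*ˡ xs c f)) (sym (ℤ.*-distribˡ-+ c (f x) (∑ xs f)))

∑-++ : (xs ys : List A) (f : A → ℤ) → ∑ (xs ++ ys) f ≡ ∑ xs f + ∑ ys f
∑-++ []       ys f = sym (ℤ.+-identityˡ _)
∑-++ (x ∷ xs) ys f = trans (cong (f x +_) (∑-++ xs ys f)) (sym (ℤ.+-assoc (f x) _ _))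

∑-map : (g : A → B) (xs : List A) (f : B → ℤ) → ∑ (map g xs) f ≡ ∑[ x ∈ xs ] f (g x)
∑-map g xs f = cong sumℤ (sym (List.map-∘ xs))

∑-concatMap : (F : A → List B) (xs : List A) (f : B → ℤ) →
              ∑ (concatMap F xs) f ≡ ∑[ x ∈ xs ] ∑ (F x) f
∑-concatMap F []       f = refl
∑-concatMap F (x ∷ xs) f = trans (∑-++ (F x) (concatMap F xs) f) (cong (∑ (F x) f +_) (∑-concatMap F xs f))

∑-comm : (xs : List A) (ys : List B) (h : A → B → ℤ) →
         ∑[ x ∈ xs ] ∑[ y ∈ ys ] h x y ≡ ∑[ y ∈ ys ] ∑[ x ∈ xs ] h x y
∑-comm []       ys h = sym (∑-zero ys)
∑-comm (x ∷ xs) ys h = begin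
  ∑ ys (h x) + ∑[ x ∈ xs ] ∑ ys (h x)        ≡⟨ cong (∑ ys (h x) +_) (∑-comm xs ys h) ⟩
  ∑ ys (h x) + ∑[ y ∈ ys ] ∑[ x ∈ xs ] h x y ≡⟨ sym (∑-+ ys (h x) _) ⟩
  ∑[ y ∈ ys ] (h x y + ∑[ x ∈ xs ] h x y)    ∎

pairs : List A → List B → List (A × B)
pairs xs ys = concatMap (λ x → map (x ,_) ys) xs

∑-pairs : (xs : List A) (ys : List B) (f : A × B → ℤ) →
          ∑ (pairs xs ys) f ≡ ∑[ x ∈ xs ] ∑[ y ∈ ys ] f (x , y)
∑-pairs xs ys f = trans (∑-concatMap _ xs f) (∑-cong xs (λ x → ∑-map (x ,_) ys f))

∑-*ʳ : (xs : List A) (c : ℤ) (f : A → ℤ) → ∑[ x ∈ xs ] (f x * c) ≡ ∑ xs f * c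
∑-*ʳ xs c f = begin
  ∑[ x ∈ xs ] (f x * c) ≡⟨ ∑-cong xs (λ x → ℤ.*-comm (f x) c) ⟩
  ∑[ x ∈ xs ] (c * f x) ≡⟨ ∑-*ˡ xs c f ⟩
  c * ∑ xs f            ≡⟨ ℤ.*-comm c _ ⟩
  ∑ xs f * c            ∎

∑-*-∑ : (xs : List A) (ys : List B) (f : A → ℤ) (g : B → ℤ) →
        ∑[ x ∈ xs ] ∑[ y ∈ ys ] (f x * g y) ≡ ∑ xs f * ∑ ys g
∑-*-∑ xs ys f g = trans (∑-cong xs (λ x → ∑-*ˡ ys (f x) g)) (∑-*ʳ xs (∑ ys g) f)

∑-*-∑-comm : (xs : List A) (ys : List B) (a : A → ℤ) (b : A → B → ℤ) (c : B → ℤ) →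
             ∑[ x ∈ xs ] (a x * ∑[ y ∈ ys ] (b x y * c y)) ≡ ∑[ y ∈ ys ] (c y * ∑[ x ∈ xs ] (b x y * a x))
∑-*-∑-comm xs ys a b c = begin
  ∑[ x ∈ xs ] (a x * ∑[ y ∈ ys ] (b x y * c y))   ≡⟨ ∑-cong xs (λ x → sym (∑-*ˡ ys (a x) _)) ⟩
  ∑[ x ∈ xs ] ∑[ y ∈ ys ] (a x * (b x y * c y))   ≡⟨ ∑-comm xs ys _ ⟩
  ∑[ y ∈ ys ] ∑[ x ∈ xs ] (a x * (b x y * c y))   ≡⟨ ∑-cong ys (λ y → ∑-cong xs (λ x → reorder (a x) (b x y) (c y))) ⟩
  ∑[ y ∈ ys ] ∑[ x ∈ xs ] (c y * (b x y * a x))   ≡⟨ ∑-cong ys (λ y → ∑-*ˡ xs (c y) _) ⟩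
  ∑[ y ∈ ys ] (c y * ∑[ x ∈ xs ] (b x y * a x))   ∎
  where
  reorder : ∀ a b c → a * (b * c) ≡ c * (b * a)
  reorder = solve-∀

δ-refl : ∀ t → δ t t ≡ 1ℤ
δ-refl t with t ≟T t
... | yes _ = refl
... | no ne = ⊥-elim (ne refl)

δ-≢ : ∀ {x t} → x ≢ t → δ x t ≡ 0ℤ
δ-≢ {x} {t} ne with x ≟T t
... | yes e = ⊥-elim (ne e)
... | no _  = refl

δ-sym : ∀ x t → δ x t ≡ δ t x
δ-sym x t with x ≟T t | t ≟T x
... | yes _ | yes _ = refl
... | no _  | no _  = refl
... | yes e | no ne = ⊥-elim (ne (sym e))
... | no ne | yes e = ⊥-elim (ne (sym e))

∑-*δ-∉ : ∀ L (f : Tree → ℤ) {t} → t ∉ L → ∑[ x ∈ L ] (f x * δ x t) ≡ 0ℤ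
∑-*δ-∉ []      f t∉ = refl
∑-*δ-∉ (y ∷ L) f t∉ = begin
  f y * δ y _ + ∑[ x ∈ L ] (f x * δ x _) ≡⟨ cong₂ (λ d s → f y * d + s) (δ-≢ (λ y≡t → t∉ (here (sym y≡t))))
                                                                      (∑-*δ-∉ L f (t∉ ∘ there)) ⟩
  f y * 0ℤ + 0ℤ                          ≡⟨ trans (ℤ.+-identityʳ _) (ℤ.*-zeroʳ (f y)) ⟩
  0ℤ                                     ∎

∑-*δ-∈ : ∀ {L} (f : Tree → ℤ) {t} → Unique L → t ∈ L → ∑[ x ∈ L ] (f x * δ x t) ≡ f t
∑-*δ-∈ {y ∷ L} f (y∉L ∷ _) (here refl) = begin
  f y * δ y y + ∑[ x ∈ L ] (f x * δ x y) ≡⟨ cong₂ (λ d s → f y * d + s) (δ-refl y)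
                                               (∑-*δ-∉ L f (λ y∈L → All.lookup y∉L y∈L refl)) ⟩
  f y * 1ℤ + 0ℤ                          ≡⟨ trans (ℤ.+-identityʳ _) (ℤ.*-identityʳ (f y)) ⟩
  f y                                    ∎
∑-*δ-∈ {y ∷ L} f {t} (y∉L ∷ uL) (there t∈L) = begin
  f y * δ y t + ∑[ x ∈ L ] (f x * δ x t) ≡⟨ cong₂ (λ d s → f y * d + s) (δ-≢ (All.lookup y∉L t∈L)) (∑-*δ-∈ f uL t∈L) ⟩
  f y * 0ℤ + f t                         ≡⟨ trans (cong (_+ f t) (ℤ.*-zeroʳ (f y))) (ℤ.+-identityˡ (f t)) ⟩
  f t                                    ∎

take-length-++ : (xs ys : List A) → take (length xs) (xs ++ ys) ≡ xs
take-length-++ []       ys = refl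
take-length-++ (x ∷ xs) ys = cong (x ∷_) (take-length-++ xs ys)

drop-length-++ : (xs ys : List A) → drop (length xs) (xs ++ ys) ≡ ys
drop-length-++ []       ys = refl
drop-length-++ (x ∷ xs) ys = drop-length-++ xs ys

0<leaves : ∀ t → 0 < leaves t
0<leaves leaf    = s≤s z≤n
0<leaves (a ∨ b) = ℕ.≤-trans (0<leaves a) (ℕ.m≤m+n (leaves a) (leaves b))

≤T⇒leaves≡ : ∀ {x y} → x ≤T y → leaves x ≡ leaves y
≤T⇒leaves≡ ≤T-refl                  = refl
≤T⇒leaves≡ (≤T-trans p q)           = trans (≤T⇒leaves≡ p) (≤T⇒leaves≡ q)
≤T⇒leaves≡ (≤T-rot {a} {b} {c})     = ℕ.+-assoc (leaves a) (leaves b) (leaves c)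
≤T⇒leaves≡ (≤T-∨ˡ {b = b} p)        = cong (ℕ._+ leaves b) (≤T⇒leaves≡ p)
≤T⇒leaves≡ (≤T-∨ʳ {a = a} p)        = cong (leaves a ℕ.+_) (≤T⇒leaves≡ p)

brackets : Tree → List ℕ
brackets leaf    = []
brackets (a ∨ b) = brackets a ++ leaves b ∷ brackets b

length-brackets : ∀ t → suc (length (brackets t)) ≡ leaves t
length-brackets leaf    = refl
length-brackets (a ∨ b) = begin
  suc (length (brackets a ++ leaves b ∷ brackets b))      ≡⟨ cong suc (List.length-++ (brackets a)) ⟩
  suc (length (brackets a) ℕ.+ suc (length (brackets b))) ≡⟨ cong₂ ℕ._+_ (length-brackets a) (length-brackets b) ⟩
  leaves a ℕ.+ leaves b                                   ∎

infix 4 _≤*_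

_≤*_ : List ℕ → List ℕ → Set
_≤*_ = Pointwise _≤_

≤*-refl : ∀ {v} → v ≤* v
≤*-refl = Pointwise.refl ℕ.≤-refl

≤*⇒length≡ : ∀ {v w} → v ≤* w → length v ≡ length w
≤*⇒length≡ = Pointwise.Pointwise-length

≤*⇒leaves≡ : ∀ {x y} → brackets x ≤* brackets y → leaves x ≡ leaves y
≤*⇒leaves≡ {x} {y} p = trans (sym (length-brackets x)) (trans (cong suc (≤*⇒length≡ p)) (length-brackets y))

≤*-split : ∀ P {Q v} → v ≤* P ++ Q → take (length P) v ≤* P × drop (length P) v ≤* Q
≤*-split []      p       = [] , p
≤*-split (_ ∷ P) (x ∷ p) = let (q₁ , q₂) = ≤*-split P p in x ∷ q₁ , q₂

≤*-split-∷ : ∀ P {x Q w} → P ++ x ∷ Q ≤* w →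
             ∃[ P′ ] ∃[ c ] ∃[ Q′ ] w ≡ P′ ++ c ∷ Q′ × P ≤* P′ × x ≤ c × Q ≤* Q′
≤*-split-∷ []      {w = c ∷ Q′} (x ∷ p) = [] , c , Q′ , refl , [] , x , p
≤*-split-∷ (_ ∷ P) {w = y ∷ w}  (x ∷ p) with ≤*-split-∷ P p
... | P′ , c , Q′ , refl , pP , pc , pQ = y ∷ P′ , c , Q′ , refl , x ∷ pP , pc , pQ

infix 4 _≤*ᵇ_

_≤*ᵇ_ : List ℕ → List ℕ → Bool
[]     ≤*ᵇ []     = true
[]     ≤*ᵇ _ ∷ _  = false
_ ∷ _  ≤*ᵇ []     = false
x ∷ xs ≤*ᵇ y ∷ ys = (x ≤ᵇ y) ∧ (xs ≤*ᵇ ys)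

≤⇒≤ᵇ≡true : ∀ {m n} → m ≤ n → (m ≤ᵇ n) ≡ true
≤⇒≤ᵇ≡true = Equivalence.to Bool.T-≡ ∘ ℕ.≤⇒≤ᵇ

≤ᵇ≡true⇒≤ : ∀ m n → (m ≤ᵇ n) ≡ true → m ≤ n
≤ᵇ≡true⇒≤ m n = ℕ.≤ᵇ⇒≤ m n ∘ Equivalence.from Bool.T-≡

≰⇒≤ᵇ≡false : ∀ {m n} → ¬ m ≤ n → (m ≤ᵇ n) ≡ false
≰⇒≤ᵇ≡false {m} {n} m≰n with m ≤ᵇ n in eq
... | true  = ⊥-elim (m≰n (≤ᵇ≡true⇒≤ m n eq))
... | false = refl

≤*ᵇ⇒≤* : ∀ v w → (v ≤*ᵇ w) ≡ true → v ≤* w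
≤*ᵇ⇒≤* []       []       _ = []
≤*ᵇ⇒≤* (x ∷ xs) (y ∷ ys) e with x ≤ᵇ y in eq
... | true = ≤ᵇ≡true⇒≤ x y eq ∷ ≤*ᵇ⇒≤* xs ys e

≤*⇒≤*ᵇ : ∀ {v w} → v ≤* w → (v ≤*ᵇ w) ≡ true
≤*⇒≤*ᵇ []       = refl
≤*⇒≤*ᵇ (p ∷ ps) rewrite ≤⇒≤ᵇ≡true p = ≤*⇒≤*ᵇ ps

≤*ᵇ-++ : ∀ v P Q → (v ≤*ᵇ P ++ Q) ≡ (take (length P) v ≤*ᵇ P) ∧ (drop (length P) v ≤*ᵇ Q)
≤*ᵇ-++ v       []      Q = refl
≤*ᵇ-++ []      (p ∷ P) Q = refl
≤*ᵇ-++ (x ∷ v) (p ∷ P) Q rewrite ≤*ᵇ-++ v P Q = sym (Bool.∧-assoc (x ≤ᵇ p) _ _)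

≤T⇒≤* : ∀ {x y} → x ≤T y → brackets x ≤* brackets y
≤T⇒≤* ≤T-refl        = ≤*-refl
≤T⇒≤* (≤T-trans p q) = Pointwise.transitive ℕ.≤-trans (≤T⇒≤* p) (≤T⇒≤* q)
≤T⇒≤* (≤T-rot {a} {b} {c})
  rewrite List.++-assoc (brackets a) (leaves b ∷ brackets b) (leaves c ∷ brackets c)
  = Pointwise.++⁺ (≤*-refl {brackets a}) (ℕ.m≤m+n (leaves b) (leaves c) ∷ ≤*-refl)
≤T⇒≤* (≤T-∨ˡ p)           = Pointwise.++⁺ (≤T⇒≤* p) ≤*-refl
≤T⇒≤* (≤T-∨ʳ {a = a} p)   = Pointwise.++⁺ (≤*-refl {brackets a}) (ℕ.≤-reflexive (≤T⇒leaves≡ p) ∷ ≤T⇒≤* p)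

≤T⇒length-brackets≡ : ∀ {x y} → x ≤T y → length (brackets x) ≡ length (brackets y)
≤T⇒length-brackets≡ = ≤*⇒length≡ ∘ ≤T⇒≤*

Bounded : List ℕ → Set
Bounded []       = ⊤
Bounded (v ∷ vs) = v ≤ suc (length vs) × Bounded vs

Bounded-++ : ∀ xs {ys} → Bounded xs → Bounded ys → Bounded (xs ++ ys)
Bounded-++ []       _          b = b
Bounded-++ (x ∷ xs) {ys} (p , bx) b =
  ℕ.≤-trans p (s≤s (subst (length xs ℕ.≤_) (sym (List.length-++ xs)) (ℕ.m≤m+n (length xs) (length ys)))) ,
  Bounded-++ xs bx b

Bounded-++⁻ʳ : ∀ xs {ys} → Bounded (xs ++ ys) → Bounded ys
Bounded-++⁻ʳ []       b       = b
Bounded-++⁻ʳ (x ∷ xs) (_ , b) = Bounded-++⁻ʳ xs b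

Bounded-drop : ∀ n v → Bounded v → Bounded (drop n v)
Bounded-drop zero    v       b       = b
Bounded-drop (suc n) []      b       = b
Bounded-drop (suc n) (x ∷ v) (_ , b) = Bounded-drop n v b

brackets-bounded : ∀ t → Bounded (brackets t)
brackets-bounded leaf    = tt
brackets-bounded (a ∨ b) =
  Bounded-++ (brackets a) (brackets-bounded a) (ℕ.≤-reflexive (sym (length-brackets b)) , brackets-bounded b)

brackets-entry-bound : ∀ t P c Q → brackets t ≡ P ++ c ∷ Q → c ≤ suc (length Q)
brackets-entry-bound t P c Q e = proj₁ (Bounded-++⁻ʳ P (subst Bounded e (brackets-bounded t)))

data Splits (P : List A) (x : A) (Q P′ : List A) (x′ : A) (Q′ : List A) : Set where
  same    : P ≡ P′ → x ≡ x′ → Q ≡ Q′ → Splits P x Q P′ x′ Q′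
  earlier : ∀ D → P′ ≡ P ++ x ∷ D → Q ≡ D ++ x′ ∷ Q′ → Splits P x Q P′ x′ Q′
  later   : ∀ D → P ≡ P′ ++ x′ ∷ D → Q′ ≡ D ++ x ∷ Q → Splits P x Q P′ x′ Q′

compareSplits : (P : List A) (x : A) (Q P′ : List A) (x′ : A) (Q′ : List A) →
                P ++ x ∷ Q ≡ P′ ++ x′ ∷ Q′ → Splits P x Q P′ x′ Q′
compareSplits []      x Q []       x′ Q′ refl = same refl refl refl
compareSplits []      x Q (_ ∷ P′) x′ Q′ refl = earlier P′ refl refl
compareSplits (_ ∷ P) x Q []       x′ Q′ refl = later P refl refl
compareSplits (a ∷ P) x Q (_ ∷ P′) x′ Q′ e with List.∷-injective e
... | refl , e′ with compareSplits P x Q P′ x′ Q′ e′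
...   | same p q s      = same (cong (a ∷_) p) q s
...   | earlier D p q   = earlier D (cong (a ∷_) p) q
...   | later D p q     = later D (cong (a ∷_) p) q

length-brackets-++ : ∀ t D → suc (length (brackets t ++ D)) ≡ leaves t ℕ.+ length D
length-brackets-++ t D = trans (cong suc (List.length-++ (brackets t)))
                               (cong (ℕ._+ length D) (length-brackets t))

-- The entry c of brackets y after P belongs to a node whose right subtree yR holds the
-- last c leaves; rotating that node up to the root gives yL ∨ yR.  The entries of P
-- that reached beyond leaf |P| + 1 are cut down in brackets yL, which is invisible to
-- Bounded vectors.
split-below : ∀ y P c Q → brackets y ≡ P ++ c ∷ Q → leaves y ≡ suc (length P) ℕ.+ c →
  ∃[ yL ] ∃[ yR ] leaves yL ≡ suc (length P) × brackets yR ≡ Q × (yL ∨ yR) ≤T y ×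
                  (∀ v → Bounded v → v ≤* P → v ≤* brackets yL)
split-below leaf      []      c Q () _
split-below leaf      (_ ∷ _) c Q () _
split-below (y₁ ∨ y₂) P c Q e l with compareSplits (brackets y₁) (leaves y₂) (brackets y₂) P c Q e
... | same refl refl refl =
  y₁ , y₂ , sym (length-brackets y₁) , refl , ≤T-refl , (λ v _ v≤P → v≤P)
... | earlier D refl e₂
  with split-below y₂ D c Q e₂ (ℕ.+-cancelˡ-≡ (leaves y₁) _ _ (begin
         leaves y₁ ℕ.+ leaves y₂                                   ≡⟨ l ⟩
         suc (length (brackets y₁ ++ leaves y₂ ∷ D)) ℕ.+ c         ≡⟨ cong (ℕ._+ c) (length-brackets-++ y₁ _) ⟩
         leaves y₁ ℕ.+ suc (length D) ℕ.+ c                        ≡⟨ ℕ.+-assoc (leaves y₁) _ c ⟩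
         leaves y₁ ℕ.+ (suc (length D) ℕ.+ c)                      ∎))
... | yL , yR , lL , bR , le , below =
  y₁ ∨ yL , yR , trans (cong (leaves y₁ ℕ.+_) lL) (sym (length-brackets-++ y₁ _)) , bR ,
  ≤T-trans ≤T-rot (≤T-∨ʳ le) , below′
  where
  below-∷ : ∀ u → Bounded u → u ≤* leaves y₂ ∷ D → u ≤* leaves yL ∷ brackets yL
  below-∷ (x ∷ w) (x≤ , bw) (_ ∷ w≤D) =
    subst (x ≤_) (trans (cong suc (≤*⇒length≡ w≤D)) (sym lL)) x≤ ∷ below w bw w≤D
  below′ : ∀ v → Bounded v → v ≤* brackets y₁ ++ leaves y₂ ∷ D → v ≤* brackets (y₁ ∨ yL)
  below′ v bv v≤ with ≤*-split (brackets y₁) v≤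
  ... | p₁ , p₂ = subst (_≤* _) (List.take++drop≡id (length (brackets y₁)) v)
                    (Pointwise.++⁺ p₁ (below-∷ _ (Bounded-drop (length (brackets y₁)) v bv) p₂))
split-below (y₁ ∨ y₂) P c Q e l | later D e₁ refl =
  ⊥-elim (ℕ.<⇒≱ (ℕ.m<m+n (leaves y₁) (0<leaves y₂)) (subst (_≤ leaves y₁) (sym l) y≤y₁))
  where
  y≤y₁ : suc (length P) ℕ.+ c ≤ leaves y₁
  y≤y₁ = ℕ.≤-trans (ℕ.+-monoʳ-≤ (suc (length P)) (brackets-entry-bound y₁ P c D e₁)) (ℕ.≤-reflexive (begin
    suc (length P) ℕ.+ suc (length D)  ≡⟨ cong suc (sym (List.length-++ P)) ⟩
    suc (length (P ++ c ∷ D))          ≡⟨ cong (suc ∘ length) (sym e₁) ⟩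
    suc (length (brackets y₁))         ≡⟨ length-brackets y₁ ⟩
    leaves y₁                          ∎))

≤*⇒≤T : ∀ x y → brackets x ≤* brackets y → x ≤T y
≤*⇒≤T leaf      leaf    _ = ≤T-refl
≤*⇒≤T leaf      (a ∨ b) p =
  ⊥-elim (ℕ.<-irrefl (≤*⇒leaves≡ {leaf} {a ∨ b} p) (ℕ.+-mono-≤ (0<leaves a) (0<leaves b)))
≤*⇒≤T (x₁ ∨ x₂) y p with ≤*-split-∷ (brackets x₁) p
... | P , c , Q , e , x₁≤P , x₂≤c , x₂≤Q with split-below y P c Q e leaves-y
  where
  c≡x₂ : c ≡ leaves x₂
  c≡x₂ = ℕ.≤-antisym
    (subst (c ≤_) (trans (cong suc (sym (≤*⇒length≡ x₂≤Q))) (length-brackets x₂)) (brackets-entry-bound y P c Q e))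
    x₂≤c
  leaves-y : leaves y ≡ suc (length P) ℕ.+ c
  leaves-y = begin
    leaves y                                    ≡⟨ sym (≤*⇒leaves≡ {x₁ ∨ x₂} {y} p) ⟩
    leaves x₁ ℕ.+ leaves x₂                     ≡⟨ cong₂ ℕ._+_ (sym (length-brackets x₁)) (sym c≡x₂) ⟩
    suc (length (brackets x₁)) ℕ.+ c            ≡⟨ cong (λ n → suc n ℕ.+ c) (≤*⇒length≡ x₁≤P) ⟩
    suc (length P) ℕ.+ c                        ∎
... | yL , yR , _ , bR , yL∨yR≤y , below =
  ≤T-trans (≤T-trans (≤T-∨ˡ (≤*⇒≤T x₁ yL (below _ (brackets-bounded x₁) x₁≤P)))
                     (≤T-∨ʳ (≤*⇒≤T x₂ yR (subst (_ ≤*_) (sym bR) x₂≤Q))))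
           yL∨yR≤y

infix 4 _≤Tᵇ_

_≤Tᵇ_ : Tree → Tree → Bool
x ≤Tᵇ y = brackets x ≤*ᵇ brackets y

≤Tᵇ⇒≤T : ∀ x y → (x ≤Tᵇ y) ≡ true → x ≤T y
≤Tᵇ⇒≤T x y e = ≤*⇒≤T x y (≤*ᵇ⇒≤* (brackets x) (brackets y) e)

≤T⇒≤Tᵇ : ∀ {x y} → x ≤T y → (x ≤Tᵇ y) ≡ true
≤T⇒≤Tᵇ = ≤*⇒≤*ᵇ ∘ ≤T⇒≤*

≤Tᵇ≡false⇒≰T : ∀ {x y} → (x ≤Tᵇ y) ≡ false → ¬ x ≤T y
≤Tᵇ≡false⇒≰T eq x≤y with () ← trans (sym (≤T⇒≤Tᵇ x≤y)) eq

data Edge : Tree → Set where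
  root : ∀ {a b c} → Edge (a ∨ (b ∨ c))
  inL  : ∀ {a b} → Edge a → Edge (a ∨ b)
  inR  : ∀ {a b} → Edge b → Edge (a ∨ b)

rotateAt : (t : Tree) → Edge t → Tree
rotateAt (a ∨ b)       (inL e) = rotateAt a e ∨ b
rotateAt (a ∨ b)       (inR e) = a ∨ rotateAt b e
rotateAt (a ∨ (b ∨ c)) root    = (a ∨ b) ∨ c

rotateAt-≤T : ∀ t e → rotateAt t e ≤T t
rotateAt-≤T (a ∨ b)       (inL e) = ≤T-∨ˡ (rotateAt-≤T a e)
rotateAt-≤T (a ∨ b)       (inR e) = ≤T-∨ʳ (rotateAt-≤T b e)
rotateAt-≤T (a ∨ (b ∨ c)) root    = ≤T-rot

≤T⇒≡⊎≤T-rotateAt : ∀ {x t} → x ≤T t → x ≡ t ⊎ ∃[ e ] x ≤T rotateAt t e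
≤T⇒≡⊎≤T-rotateAt ≤T-refl = inj₁ refl
≤T⇒≡⊎≤T-rotateAt (≤T-trans p q) with ≤T⇒≡⊎≤T-rotateAt q
... | inj₁ refl    = ≤T⇒≡⊎≤T-rotateAt p
... | inj₂ (e , r) = inj₂ (e , ≤T-trans p r)
≤T⇒≡⊎≤T-rotateAt ≤T-rot = inj₂ (root , ≤T-refl)
≤T⇒≡⊎≤T-rotateAt (≤T-∨ˡ p) with ≤T⇒≡⊎≤T-rotateAt p
... | inj₁ refl    = inj₁ refl
... | inj₂ (e , r) = inj₂ (inL e , ≤T-∨ˡ r)
≤T⇒≡⊎≤T-rotateAt (≤T-∨ʳ p) with ≤T⇒≡⊎≤T-rotateAt p
... | inj₁ refl    = inj₁ refl
... | inj₂ (e , r) = inj₂ (inR e , ≤T-∨ʳ r)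

-- A marking of t is a set of its edges (one Bool per internal right child), and
-- rotateMarked rotates all marked edges at once.  rotateMarkedʳ g b m is g ∨ b with
-- the edges of b marked by m rotated, the Bool of b marking the edge from the root to b.
Marking  : Tree → Set
Markingʳ : Tree → Set
Marking leaf     = ⊤
Marking (a ∨ b)  = Marking a × Markingʳ b
Markingʳ leaf    = ⊤
Markingʳ (b ∨ c) = Bool × Marking (b ∨ c)

rotateMarked  : (t : Tree) → Marking t → Tree
rotateMarkedʳ : Tree → (b : Tree) → Markingʳ b → Tree
rotateMarked leaf    _          = leaf
rotateMarked (a ∨ b) (ma , mb)  = rotateMarkedʳ (rotateMarked a ma) b mb
rotateMarkedʳ g leaf    _                  = g ∨ leaf
rotateMarkedʳ g (b ∨ c) (true  , mb , mc) = rotateMarkedʳ (g ∨ rotateMarked b mb) c mc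
rotateMarkedʳ g (b ∨ c) (false , mb , mc) = g ∨ rotateMarkedʳ (rotateMarked b mb) c mc

rotateMarked-≤T  : ∀ t m → rotateMarked t m ≤T t
rotateMarkedʳ-≤T : ∀ g b m → rotateMarkedʳ g b m ≤T (g ∨ b)
rotateMarked-≤T leaf    _         = ≤T-refl
rotateMarked-≤T (a ∨ b) (ma , mb) =
  ≤T-trans (rotateMarkedʳ-≤T (rotateMarked a ma) b mb) (≤T-∨ˡ (rotateMarked-≤T a ma))
rotateMarkedʳ-≤T g leaf    _                  = ≤T-refl
rotateMarkedʳ-≤T g (b ∨ c) (true  , mb , mc) =
  ≤T-trans (rotateMarkedʳ-≤T (g ∨ rotateMarked b mb) c mc)
           (≤T-trans ≤T-rot (≤T-∨ʳ (≤T-∨ˡ (rotateMarked-≤T b mb))))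
rotateMarkedʳ-≤T g (b ∨ c) (false , mb , mc) =
  ≤T-∨ʳ (≤T-trans (rotateMarkedʳ-≤T (rotateMarked b mb) c mc) (≤T-∨ˡ (rotateMarked-≤T b mb)))

edgeSign : Bool → ℤ
edgeSign true  = -1ℤ
edgeSign false = 1ℤ

sign  : (t : Tree) → Marking t → ℤ
signʳ : (b : Tree) → Markingʳ b → ℤ
sign leaf    _                = 1ℤ
sign (a ∨ b) (ma , mb)        = sign a ma * signʳ b mb
signʳ leaf    _               = 1ℤ
signʳ (b ∨ c) (bit , m)       = edgeSign bit * sign (b ∨ c) m

markings  : (t : Tree) → List (Marking t)
markingsʳ : (b : Tree) → List (Markingʳ b)
markings leaf     = tt ∷ []
markings (a ∨ b)  = pairs (markings a) (markingsʳ b)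
markingsʳ leaf    = tt ∷ []
markingsʳ (b ∨ c) = pairs (true ∷ false ∷ []) (markings (b ∨ c))

rotationSum : Tree → LC
rotationSum t = map (λ m → (sign t m , rotateMarked t m)) (markings t)

bracketsʳ : (b : Tree) → Markingʳ b → List ℕ
bracketsʳ leaf    _         = 1 ∷ []
bracketsʳ (b ∨ c) (bit , m) = (if bit then leaves b else leaves (b ∨ c)) ∷ brackets (rotateMarked (b ∨ c) m)

brackets-rotateMarkedʳ : ∀ g b m → brackets (rotateMarkedʳ g b m) ≡ brackets g ++ bracketsʳ b m
brackets-rotateMarkedʳ g leaf    _                  = refl
brackets-rotateMarkedʳ g (b ∨ c) (true  , mb , mc) = begin
  brackets (rotateMarkedʳ (g ∨ b′) c mc)                 ≡⟨ brackets-rotateMarkedʳ (g ∨ b′) c mc ⟩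
  (brackets g ++ leaves b′ ∷ brackets b′) ++ bracketsʳ c mc ≡⟨ List.++-assoc (brackets g) _ _ ⟩
  brackets g ++ leaves b′ ∷ (brackets b′ ++ bracketsʳ c mc) ≡⟨ cong₂ (λ n v → brackets g ++ n ∷ v)
                                                                   (≤T⇒leaves≡ (rotateMarked-≤T b mb))
                                                                   (sym (brackets-rotateMarkedʳ b′ c mc)) ⟩
  brackets g ++ leaves b ∷ brackets (rotateMarkedʳ b′ c mc) ∎
  where b′ = rotateMarked b mb
brackets-rotateMarkedʳ g (b ∨ c) (false , mb , mc) =
  cong (λ n → brackets g ++ n ∷ brackets (rotateMarkedʳ b′ c mc))
       (trans (≤T⇒leaves≡ (rotateMarkedʳ-≤T b′ c mc)) (cong (ℕ._+ leaves c) (≤T⇒leaves≡ (rotateMarked-≤T b mb))))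
  where b′ = rotateMarked b mb

𝟙 : Bool → ℤ
𝟙 true  = 1ℤ
𝟙 false = 0ℤ

𝟙-∧ : ∀ a b → 𝟙 (a ∧ b) ≡ 𝟙 a * 𝟙 b
𝟙-∧ true  b = sym (ℤ.*-identityˡ (𝟙 b))
𝟙-∧ false b = refl

signedCount : Tree → List ℕ → ℤ
signedCount t v = ∑[ m ∈ markings t ] (sign t m * 𝟙 (v ≤*ᵇ brackets (rotateMarked t m)))

signedCountʳ : Tree → List ℕ → ℤ
signedCountʳ b w = ∑[ m ∈ markingsʳ b ] (signʳ b m * 𝟙 (w ≤*ᵇ bracketsʳ b m))

-- By inclusion–exclusion over the marked edges, the signed count is the indicator
-- of v lying below t but below none of the rotations of t; tightᵇ decides this locally.
tightᵇ  : Tree → List ℕ → Bool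
tightʳᵇ : Tree → List ℕ → Bool
tightᵇ leaf    v = v ≤*ᵇ []
tightᵇ (a ∨ b) v = tightᵇ a (take (length (brackets a)) v) ∧ tightʳᵇ b (drop (length (brackets a)) v)
tightʳᵇ leaf    w       = w ≤*ᵇ 1 ∷ []
tightʳᵇ (b ∨ c) []      = false
tightʳᵇ (b ∨ c) (e ∷ w) = (e ≤ᵇ leaves (b ∨ c)) ∧ (not (e ≤ᵇ leaves b) ∧ tightᵇ (b ∨ c) w)

signedCount-∨ : ∀ a b v → signedCount (a ∨ b) v ≡
  signedCount a (take (length (brackets a)) v) * signedCountʳ b (drop (length (brackets a)) v)
signedCount-∨ a b v = begin
  signedCount (a ∨ b) v
    ≡⟨ ∑-pairs (markings a) (markingsʳ b) _ ⟩
  ∑[ ma ∈ markings a ] ∑[ mb ∈ markingsʳ b ]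
    ((sign a ma * signʳ b mb) * 𝟙 (v ≤*ᵇ brackets (rotateMarkedʳ (rotateMarked a ma) b mb)))
    ≡⟨ ∑-cong (markings a) (λ ma → ∑-cong (markingsʳ b) (λ mb → split-term ma mb)) ⟩
  ∑[ ma ∈ markings a ] ∑[ mb ∈ markingsʳ b ]
    ((sign a ma * 𝟙 (take k v ≤*ᵇ brackets (rotateMarked a ma))) * (signʳ b mb * 𝟙 (drop k v ≤*ᵇ bracketsʳ b mb)))
    ≡⟨ ∑-*-∑ (markings a) (markingsʳ b) _ _ ⟩
  signedCount a (take k v) * signedCountʳ b (drop k v) ∎
  where
  k = length (brackets a)
  split-≤*ᵇ : ∀ ma mb → (v ≤*ᵇ brackets (rotateMarkedʳ (rotateMarked a ma) b mb)) ≡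
                        (take k v ≤*ᵇ brackets (rotateMarked a ma)) ∧ (drop k v ≤*ᵇ bracketsʳ b mb)
  split-≤*ᵇ ma mb rewrite brackets-rotateMarkedʳ (rotateMarked a ma) b mb
                        | ≤*ᵇ-++ v (brackets (rotateMarked a ma)) (bracketsʳ b mb)
                        | ≤T⇒length-brackets≡ (rotateMarked-≤T a ma) = refl
  split-term : ∀ ma mb →
    (sign a ma * signʳ b mb) * 𝟙 (v ≤*ᵇ brackets (rotateMarkedʳ (rotateMarked a ma) b mb)) ≡
    (sign a ma * 𝟙 (take k v ≤*ᵇ brackets (rotateMarked a ma))) * (signʳ b mb * 𝟙 (drop k v ≤*ᵇ bracketsʳ b mb))
  split-term ma mb rewrite split-≤*ᵇ ma mb | 𝟙-∧ (take k v ≤*ᵇ brackets (rotateMarked a ma)) (drop k v ≤*ᵇ bracketsʳ b mb)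
    = *-interchange (sign a ma) (signʳ b mb) _ _

𝟙-inclusion-exclusion : ∀ x y s → (x ≡ true → y ≡ true) →
  (-1ℤ * 𝟙 x) * 𝟙 s + ((1ℤ * 𝟙 y) * 𝟙 s + 0ℤ) ≡ 𝟙 (y ∧ (not x ∧ s))
𝟙-inclusion-exclusion true  true  true  _ = refl
𝟙-inclusion-exclusion true  true  false _ = refl
𝟙-inclusion-exclusion true  false s     x⇒y with () ← x⇒y refl
𝟙-inclusion-exclusion false true  true  _ = refl
𝟙-inclusion-exclusion false true  false _ = refl
𝟙-inclusion-exclusion false false true  _ = refl
𝟙-inclusion-exclusion false false false _ = refl

signedCountʳ-∷ : ∀ b c e w → signedCountʳ (b ∨ c) (e ∷ w) ≡
  (-1ℤ * 𝟙 (e ≤ᵇ leaves b)) * signedCount (b ∨ c) w + ((1ℤ * 𝟙 (e ≤ᵇ leaves (b ∨ c))) * signedCount (b ∨ c) w + 0ℤ)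
signedCountʳ-∷ b c e w = begin
  signedCountʳ (b ∨ c) (e ∷ w)    ≡⟨ ∑-pairs (true ∷ false ∷ []) (markings (b ∨ c)) _ ⟩
  byBit true + (byBit false + 0ℤ) ≡⟨ cong₂ (λ x y → x + (y + 0ℤ)) (byBit≡ true) (byBit≡ false) ⟩
  _                               ∎
  where
  entry : Bool → ℕ
  entry bit = if bit then leaves b else leaves (b ∨ c)
  byBit : Bool → ℤ
  byBit bit = ∑[ m ∈ markings (b ∨ c) ] (signʳ (b ∨ c) (bit , m) * 𝟙 (e ∷ w ≤*ᵇ bracketsʳ (b ∨ c) (bit , m)))
  byBit≡ : ∀ bit → byBit bit ≡ (edgeSign bit * 𝟙 (e ≤ᵇ entry bit)) * signedCount (b ∨ c) w
  byBit≡ bit = trans (∑-cong (markings (b ∨ c)) byTerm)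
                     (∑-*ˡ (markings (b ∨ c)) (edgeSign bit * 𝟙 (e ≤ᵇ entry bit))
                           (λ m → sign (b ∨ c) m * 𝟙 (w ≤*ᵇ brackets (rotateMarked (b ∨ c) m))))
    where
    byTerm : ∀ m → signʳ (b ∨ c) (bit , m) * 𝟙 (e ∷ w ≤*ᵇ bracketsʳ (b ∨ c) (bit , m)) ≡
                   (edgeSign bit * 𝟙 (e ≤ᵇ entry bit)) * (sign (b ∨ c) m * 𝟙 (w ≤*ᵇ brackets (rotateMarked (b ∨ c) m)))
    byTerm m rewrite 𝟙-∧ (e ≤ᵇ entry bit) (w ≤*ᵇ brackets (rotateMarked (b ∨ c) m)) =
      *-interchange (edgeSign bit) (sign (b ∨ c) m) (𝟙 (e ≤ᵇ entry bit)) (𝟙 (w ≤*ᵇ brackets (rotateMarked (b ∨ c) m)))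

signedCount≡𝟙tight-∨ : ∀ a b v →
  signedCount a (take (length (brackets a)) v) ≡ 𝟙 (tightᵇ a (take (length (brackets a)) v)) →
  signedCountʳ b (drop (length (brackets a)) v) ≡ 𝟙 (tightʳᵇ b (drop (length (brackets a)) v)) →
  signedCount (a ∨ b) v ≡ 𝟙 (tightᵇ (a ∨ b) v)
signedCount≡𝟙tight-∨ a b v eqa eqb = begin
  signedCount (a ∨ b) v                                ≡⟨ signedCount-∨ a b v ⟩
  signedCount a (take k v) * signedCountʳ b (drop k v) ≡⟨ cong₂ _*_ eqa eqb ⟩
  𝟙 (tightᵇ a (take k v)) * 𝟙 (tightʳᵇ b (drop k v))   ≡⟨ sym (𝟙-∧ (tightᵇ a (take k v)) (tightʳᵇ b (drop k v))) ⟩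
  𝟙 (tightᵇ (a ∨ b) v)                                 ∎
  where k = length (brackets a)

signedCount≡𝟙tight  : ∀ t v → signedCount t v ≡ 𝟙 (tightᵇ t v)
signedCountʳ≡𝟙tight : ∀ b w → signedCountʳ b w ≡ 𝟙 (tightʳᵇ b w)
signedCount≡𝟙tight leaf    v = trans (ℤ.+-identityʳ _) (ℤ.*-identityˡ _)
signedCount≡𝟙tight (a ∨ b) v =
  signedCount≡𝟙tight-∨ a b v (signedCount≡𝟙tight a _) (signedCountʳ≡𝟙tight b _)
signedCountʳ≡𝟙tight leaf    w      = trans (ℤ.+-identityʳ _) (ℤ.*-identityˡ _)
signedCountʳ≡𝟙tight (b ∨ c) []     =
  trans (∑-cong (markingsʳ (b ∨ c)) (λ m → ℤ.*-zeroʳ (signʳ (b ∨ c) m))) (∑-zero (markingsʳ (b ∨ c)))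
signedCountʳ≡𝟙tight (b ∨ c) (e ∷ w) = begin
  signedCountʳ (b ∨ c) (e ∷ w)
    ≡⟨ signedCountʳ-∷ b c e w ⟩
  (-1ℤ * 𝟙 (e ≤ᵇ leaves b)) * signedCount (b ∨ c) w + ((1ℤ * 𝟙 (e ≤ᵇ leaves (b ∨ c))) * signedCount (b ∨ c) w + 0ℤ)
    ≡⟨ cong (λ s → (-1ℤ * 𝟙 (e ≤ᵇ leaves b)) * s + ((1ℤ * 𝟙 (e ≤ᵇ leaves (b ∨ c))) * s + 0ℤ))
            (signedCount≡𝟙tight-∨ b c w (signedCount≡𝟙tight b _) (signedCountʳ≡𝟙tight c _)) ⟩
  (-1ℤ * 𝟙 (e ≤ᵇ leaves b)) * 𝟙 (tightᵇ (b ∨ c) w) + ((1ℤ * 𝟙 (e ≤ᵇ leaves (b ∨ c))) * 𝟙 (tightᵇ (b ∨ c) w) + 0ℤ)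
    ≡⟨ 𝟙-inclusion-exclusion (e ≤ᵇ leaves b) (e ≤ᵇ leaves (b ∨ c)) (tightᵇ (b ∨ c) w) b⇒b∨c ⟩
  𝟙 (tightʳᵇ (b ∨ c) (e ∷ w)) ∎
  where
  b⇒b∨c : (e ≤ᵇ leaves b) ≡ true → (e ≤ᵇ leaves (b ∨ c)) ≡ true
  b⇒b∨c e≤b = ≤⇒≤ᵇ≡true (ℕ.≤-trans (≤ᵇ≡true⇒≤ e (leaves b) e≤b) (ℕ.m≤m+n (leaves b) (leaves c)))

tightᵇ-∨ : ∀ a b → tightᵇ a (brackets a) ≡ true → tightʳᵇ b (leaves b ∷ brackets b) ≡ true →
           tightᵇ (a ∨ b) (brackets (a ∨ b)) ≡ true
tightᵇ-∨ a b p q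
  rewrite take-length-++ (brackets a) (leaves b ∷ brackets b)
        | drop-length-++ (brackets a) (leaves b ∷ brackets b) | p | q = refl

tightᵇ-brackets  : ∀ t → tightᵇ t (brackets t) ≡ true
tightʳᵇ-brackets : ∀ b → tightʳᵇ b (leaves b ∷ brackets b) ≡ true
tightᵇ-brackets leaf    = refl
tightᵇ-brackets (a ∨ b) = tightᵇ-∨ a b (tightᵇ-brackets a) (tightʳᵇ-brackets b)
tightʳᵇ-brackets leaf    = refl
tightʳᵇ-brackets (b ∨ c)
  rewrite ≤⇒≤ᵇ≡true (ℕ.≤-refl {leaves (b ∨ c)})
        | ≰⇒≤ᵇ≡false (ℕ.<⇒≱ (ℕ.m<m+n (leaves b) (0<leaves c)))
        | tightᵇ-∨ b c (tightᵇ-brackets b) (tightʳᵇ-brackets c) = refl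

tightᵇ-rotateAt : ∀ t (e : Edge t) v → v ≤* brackets (rotateAt t e) → tightᵇ t v ≡ false
tightᵇ-rotateAt (a ∨ b) (inL e) v p with ≤*-split (brackets (rotateAt a e)) p
... | p₁ , _ rewrite ≤T⇒length-brackets≡ (rotateAt-≤T a e) | tightᵇ-rotateAt a e _ p₁ = refl
tightᵇ-rotateAt (a ∨ (b₁ ∨ b₂)) (inR e) v p with ≤*-split (brackets a) p
... | _ , p₂ = trans (cong (tightᵇ a _ ∧_) (right _ p₂)) (Bool.∧-zeroʳ _)
  where
  right : ∀ u → u ≤* leaves (rotateAt (b₁ ∨ b₂) e) ∷ brackets (rotateAt (b₁ ∨ b₂) e) →
          tightʳᵇ (b₁ ∨ b₂) u ≡ false
  right (x ∷ w) (_ ∷ q) rewrite tightᵇ-rotateAt (b₁ ∨ b₂) e w q | Bool.∧-zeroʳ (not (x ≤ᵇ leaves b₁)) =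
    Bool.∧-zeroʳ (x ≤ᵇ leaves (b₁ ∨ b₂))
tightᵇ-rotateAt (a ∨ (b ∨ c)) root v p
  with ≤*-split (brackets a) (subst (v ≤*_) (List.++-assoc (brackets a) (leaves b ∷ brackets b) (leaves c ∷ brackets c)) p)
... | _ , p₂ = trans (cong (tightᵇ a _ ∧_) (right _ p₂)) (Bool.∧-zeroʳ _)
  where
  right : ∀ u → u ≤* leaves b ∷ (brackets b ++ leaves c ∷ brackets c) → tightʳᵇ (b ∨ c) u ≡ false
  right (x ∷ w) (x≤b ∷ _) rewrite ≤⇒≤ᵇ≡true x≤b = Bool.∧-zeroʳ _

signedCount-δ : ∀ {x t} → x ≤T t → signedCount t (brackets x) ≡ δ x t
signedCount-δ {x} {t} x≤t rewrite signedCount≡𝟙tight t (brackets x) with x ≟T t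
... | yes refl rewrite tightᵇ-brackets x = refl
... | no x≢t with ≤T⇒≡⊎≤T-rotateAt x≤t
...   | inj₁ x≡t       = ⊥-elim (x≢t x≡t)
...   | inj₂ (e , x≤e) rewrite tightᵇ-rotateAt t e (brackets x) (≤T⇒≤* x≤e) = refl

eval : LC → (Tree → ℤ) → ℤ
eval f h = ∑[ p ∈ f ] (proj₁ p * h (proj₂ p))

coeff≡eval-δ : ∀ f s → coeff f s ≡ eval f (λ u → δ u s)
coeff≡eval-δ []            s = refl
coeff≡eval-δ ((c , t) ∷ f) s with t ≟T s
... | yes refl = cong₂ _+_ (sym (ℤ.*-identityʳ c)) (coeff≡eval-δ f s)
... | no _     = trans (coeff≡eval-δ f s) (sym (trans (cong (_+ _) (ℤ.*-zeroʳ c)) (ℤ.+-identityˡ _)))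

eval-cong-∈ : ∀ f {h h′ : Tree → ℤ} → (∀ {p} → p ∈ f → h (proj₂ p) ≡ h′ (proj₂ p)) → eval f h ≡ eval f h′
eval-cong-∈ f e = ∑-cong-∈ f (λ {p} p∈f → cong (proj₁ p *_) (e p∈f))

eval-cong : ∀ f {h h′ : Tree → ℤ} → (∀ u → h u ≡ h′ u) → eval f h ≡ eval f h′
eval-cong f e = eval-cong-∈ f (λ {p} _ → e (proj₂ p))

eval-∑ : (f : LC) (L : List A) (k : Tree → A → ℤ) →
         eval f (λ u → ∑[ z ∈ L ] k u z) ≡ ∑[ z ∈ L ] eval f (λ u → k u z)
eval-∑ f L k = trans (∑-cong f (λ p → sym (∑-*ˡ L (proj₁ p) (k (proj₂ p)))))
                     (∑-comm f L (λ p z → proj₁ p * k (proj₂ p) z))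

∑-*coeff≡eval : ∀ L f h → Unique L → (∀ {p} → p ∈ f → proj₂ p ∈ L) →
                ∑[ z ∈ L ] (h z * coeff f z) ≡ eval f h
∑-*coeff≡eval L f h uL supp = begin
  ∑[ z ∈ L ] (h z * coeff f z)                ≡⟨ ∑-cong L (λ z → cong (h z *_) (coeff≡eval-δ f z)) ⟩
  ∑[ z ∈ L ] (h z * eval f (λ u → δ u z))     ≡⟨ ∑-cong L (λ z → sym (eval-*ˡ (h z) z)) ⟩
  ∑[ z ∈ L ] eval f (λ u → h z * δ u z)       ≡⟨ sym (eval-∑ f L (λ u z → h z * δ u z)) ⟩
  eval f (λ u → ∑[ z ∈ L ] (h z * δ u z))     ≡⟨ eval-cong-∈ f (λ {p} p∈f → pick (proj₂ p) (supp p∈f)) ⟩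
  eval f h                                    ∎
  where
  reorder : ∀ a b c → a * (b * c) ≡ b * (a * c)
  reorder = solve-∀
  eval-*ˡ : ∀ c z → eval f (λ u → c * δ u z) ≡ c * eval f (λ u → δ u z)
  eval-*ˡ c z = trans (∑-cong f (λ p → reorder (proj₁ p) c (δ (proj₂ p) z))) (∑-*ˡ f c _)
  pick : ∀ u → u ∈ L → ∑[ z ∈ L ] (h z * δ u z) ≡ h u
  pick u u∈L = trans (∑-cong L (λ z → cong (h z *_) (δ-sym u z))) (∑-*δ-∈ h uL u∈L)

eval-≈ : ∀ f f′ → f ≈ f′ → ∀ h → eval f h ≡ eval f′ h
eval-≈ f f′ f≈f′ h = begin
  eval f h                       ≡⟨ sym (∑-*coeff≡eval U f h uU (λ p∈f → ∈U (∈-++⁺ˡ p∈f))) ⟩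
  ∑[ z ∈ U ] (h z * coeff f z)   ≡⟨ ∑-cong U (λ z → cong (h z *_) (f≈f′ z)) ⟩
  ∑[ z ∈ U ] (h z * coeff f′ z)  ≡⟨ ∑-*coeff≡eval U f′ h uU (λ p∈f′ → ∈U (∈-++⁺ʳ f p∈f′)) ⟩
  eval f′ h                      ∎
  where
  U = deduplicate _≟T_ (map proj₂ (f ++ f′))
  uU : Unique U
  uU = Unique.deduplicate-! _≟T_ (map proj₂ (f ++ f′))
  ∈U : ∀ {p} → p ∈ f ++ f′ → proj₂ p ∈ U
  ∈U = ∈-deduplicate⁺ _≟T_ ∘ ∈-map⁺ proj₂

eval-rotationSum : ∀ t h → eval (rotationSum t) h ≡ ∑[ m ∈ markings t ] (sign t m * h (rotateMarked t m))
eval-rotationSum t h = ∑-map _ (markings t) _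

ζ : Tree → Tree → ℤ
ζ x z = 𝟙 (x ≤Tᵇ z)

module Möbius (D : TamariMöbius) where
  open TamariMöbius D

  ≤T⇒∈down : ∀ {w t} → w ≤T t → w ∈ down t
  ≤T⇒∈down {w} {t} = Equivalence.from (down-complete t w)

  ∈down⇒≤T : ∀ {w t} → w ∈ down t → w ≤T t
  ∈down⇒≤T {w} {t} = Equivalence.to (down-complete t w)

  ∑-down-*δ : ∀ (f : Tree → ℤ) x z → ∑[ w ∈ down z ] (f w * δ w x) ≡ ζ x z * f x
  ∑-down-*δ f x z with x ≤Tᵇ z in eq
  ... | true  = trans (∑-*δ-∈ f (down-unique z) (≤T⇒∈down (≤Tᵇ⇒≤T x z eq))) (sym (ℤ.*-identityˡ (f x)))
  ... | false = ∑-*δ-∉ (down z) f (≤Tᵇ≡false⇒≰T eq ∘ ∈down⇒≤T)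

  ζ-*-supported : ∀ {t} (f : Tree → ℤ) → (∀ s → ¬ s ≤T t → f s ≡ 0ℤ) → ∀ s → ζ s t * f s ≡ f s
  ζ-*-supported {t} f supp s with s ≤Tᵇ t in eq
  ... | true  = ℤ.*-identityˡ (f s)
  ... | false = sym (supp s (≤Tᵇ≡false⇒≰T eq))

  coeff-M : ∀ t s → coeff (M t) s ≡ μ s t
  coeff-M t s = begin
    coeff (M t) s                             ≡⟨ coeff≡eval-δ (M t) s ⟩
    eval (M t) (λ u → δ u s)                  ≡⟨ ∑-map _ (down t) _ ⟩
    ∑[ w ∈ down t ] (μ w t * δ w s)           ≡⟨ ∑-down-*δ (λ w → μ w t) s t ⟩
    ζ s t * μ s t                             ≡⟨ ζ-*-supported (λ w → μ w t) (λ w w≰t → μ-zero w t w≰t) s ⟩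
    μ s t                                     ∎

  rotationSum-⊆-down : ∀ t {p} → p ∈ rotationSum t → proj₂ p ∈ down t
  rotationSum-⊆-down t p∈ with ∈-map⁻ (λ m → sign t m , rotateMarked t m) p∈
  ... | m , _ , refl = ≤T⇒∈down (rotateMarked-≤T t m)

  coeff-rotationSum-outside : ∀ t s → ¬ s ≤T t → coeff (rotationSum t) s ≡ 0ℤ
  coeff-rotationSum-outside t s s≰t = begin
    coeff (rotationSum t) s                                        ≡⟨ coeff≡eval-δ (rotationSum t) s ⟩
    eval (rotationSum t) (λ u → δ u s)                             ≡⟨ eval-rotationSum t _ ⟩
    ∑[ m ∈ markings t ] (sign t m * δ (rotateMarked t m) s)        ≡⟨ ∑-cong (markings t) vanish ⟩
    ∑[ m ∈ markings t ] 0ℤ                                         ≡⟨ ∑-zero (markings t) ⟩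
    0ℤ                                                             ∎
    where
    vanish : ∀ m → sign t m * δ (rotateMarked t m) s ≡ 0ℤ
    vanish m = trans (cong (sign t m *_) (δ-≢ (λ r≡s → s≰t (subst (_≤T t) r≡s (rotateMarked-≤T t m)))))
                     (ℤ.*-zeroʳ (sign t m))

  ζ-*-rotationSum : ∀ {x t} → x ≤T t → ∑[ z ∈ down t ] (ζ x z * coeff (rotationSum t) z) ≡ δ x t
  ζ-*-rotationSum {x} {t} x≤t = begin
    ∑[ z ∈ down t ] (ζ x z * coeff (rotationSum t) z)    ≡⟨ ∑-*coeff≡eval (down t) (rotationSum t) (ζ x) (down-unique t)
                                                                          (rotationSum-⊆-down t) ⟩
    eval (rotationSum t) (ζ x)                           ≡⟨ eval-rotationSum t (ζ x) ⟩
    signedCount t (brackets x)                           ≡⟨ signedCount-δ x≤t ⟩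
    δ x t                                                ∎

  ζ-*-μ : ∀ s {z t} → z ≤T t → ∑[ x ∈ down t ] (ζ x z * μ s x) ≡ δ s z
  ζ-*-μ s {z} {t} z≤t = begin
    ∑[ x ∈ down t ] (ζ x z * μ s x)                      ≡⟨ ∑-cong (down t) (λ x → sym (∑-down-*δ (μ s) x z)) ⟩
    ∑[ x ∈ down t ] ∑[ w ∈ down z ] (μ s w * δ w x)      ≡⟨ ∑-comm (down t) (down z) _ ⟩
    ∑[ w ∈ down z ] ∑[ x ∈ down t ] (μ s w * δ w x)      ≡⟨ ∑-cong-∈ (down z) pick ⟩
    ∑[ w ∈ down z ] μ s w                                ≡⟨ μ-sum s z ⟩
    δ s z                                                ∎
    where
    pick : ∀ {w} → w ∈ down z → ∑[ x ∈ down t ] (μ s w * δ w x) ≡ μ s w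
    pick {w} w∈ = trans (∑-cong (down t) (λ x → cong (μ s w *_) (δ-sym w x)))
                        (∑-*δ-∈ (λ _ → μ s w) (down-unique t) (≤T⇒∈down (≤T-trans (∈down⇒≤T w∈) z≤t)))

  -- On the lower set of t, μ is a left and rotationSum t a right inverse of ζ in the
  -- incidence algebra, so the two agree by associativity.
  μ≡coeff-rotationSum : ∀ s t → μ s t ≡ coeff (rotationSum t) s
  μ≡coeff-rotationSum s t = begin
    μ s t                                                ≡⟨ sym (∑-*δ-∈ (μ s) (down-unique t) (≤T⇒∈down ≤T-refl)) ⟩
    ∑[ x ∈ down t ] (μ s x * δ x t)                      ≡⟨ ∑-cong-∈ (down t) (λ x∈ → cong (μ s _ *_)
                                                              (sym (ζ-*-rotationSum (∈down⇒≤T x∈)))) ⟩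
    ∑[ x ∈ down t ] (μ s x * ∑[ z ∈ down t ] (ζ x z * G z))
                                                         ≡⟨ ∑-*-∑-comm (down t) (down t) (μ s) ζ G ⟩
    ∑[ z ∈ down t ] (G z * ∑[ x ∈ down t ] (ζ x z * μ s x))
                                                         ≡⟨ ∑-cong-∈ (down t) (λ {z} z∈ → cong (G z *_)
                                                              (trans (ζ-*-μ s (∈down⇒≤T z∈)) (δ-sym s z))) ⟩
    ∑[ z ∈ down t ] (G z * δ z s)                        ≡⟨ ∑-down-*δ G s t ⟩
    ζ s t * G s                                          ≡⟨ ζ-*-supported G (coeff-rotationSum-outside t) s ⟩
    G s                                                  ∎
    where
    G : Tree → ℤ
    G = coeff (rotationSum t)

  M≈rotationSum : ∀ t → M t ≈ rotationSum t
  M≈rotationSum t s = trans (coeff-M t s) (μ≡coeff-rotationSum s t)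

substitute : Tree → List Tree → Tree
substitute leaf    []      = leaf
substitute leaf    (w ∷ _) = w
substitute (a ∨ b) ws      = substitute a (take (leaves a) ws) ∨ substitute b (drop (leaves a) ws)

substitute-∨ : ∀ a b us ws → length us ≡ leaves a →
               substitute (a ∨ b) (us ++ ws) ≡ substitute a us ∨ substitute b ws
substitute-∨ a b us ws us≡a rewrite sym us≡a = cong₂ (λ us′ ws′ → substitute a us′ ∨ substitute b ws′)
                                    (take-length-++ us ws) (drop-length-++ us ws)

graft-∨-≤ : ∀ a b j w → j ≤ leaves a → graft (a ∨ b) j w ≡ graft a j w ∨ b
graft-∨-≤ a b j w j≤a rewrite ≤⇒≤ᵇ≡true j≤a = refl

graft-∨-> : ∀ a b j w → leaves a < j → graft (a ∨ b) j w ≡ a ∨ graft b (j ∸ leaves a) w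
graft-∨-> a b j w a<j rewrite ≰⇒≤ᵇ≡false (ℕ.<⇒≱ a<j) = refl

leaves-≤-graft : ∀ t j w → leaves t ≤ leaves (graft t j w)
leaves-≤-graft leaf    zero          w = ℕ.≤-refl
leaves-≤-graft leaf    (suc zero)    w = 0<leaves w
leaves-≤-graft leaf    (suc (suc j)) w = ℕ.≤-refl
leaves-≤-graft (a ∨ b) j             w with j ℕ.≤? leaves a
... | yes j≤a rewrite graft-∨-≤ a b j w j≤a = ℕ.+-monoˡ-≤ (leaves b) (leaves-≤-graft a j w)
... | no  j≰a rewrite graft-∨-> a b j w (ℕ.≰⇒> j≰a) = ℕ.+-monoʳ-≤ (leaves a) (leaves-≤-graft b (j ∸ leaves a) w)

leaves-≤-graftFrom : ∀ t j ws → leaves t ≤ leaves (graftFrom t j ws)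
leaves-≤-graftFrom t j []       = ℕ.≤-refl
leaves-≤-graftFrom t j (w ∷ ws) =
  ℕ.≤-trans (leaves-≤-graftFrom t (suc j) ws) (leaves-≤-graft (graftFrom t (suc j) ws) j w)

graftFrom-∨-> : ∀ a b j ws → leaves a < j → graftFrom (a ∨ b) j ws ≡ a ∨ graftFrom b (j ∸ leaves a) ws
graftFrom-∨-> a b j []       a<j = refl
graftFrom-∨-> a b j (w ∷ ws) a<j
  rewrite graftFrom-∨-> a b (suc j) ws (ℕ.m<n⇒m<1+n a<j)
        | graft-∨-> a (graftFrom b (suc j ∸ leaves a) ws) j w a<j
        | ℕ.+-∸-assoc 1 (ℕ.<⇒≤ a<j) = refl

graftFrom-∨ : ∀ a b j ws → j ≤ leaves a →
  graftFrom (a ∨ b) j ws ≡ graftFrom a j (take (suc (leaves a ∸ j)) ws) ∨ graftFrom b 1 (drop (suc (leaves a ∸ j)) ws)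
graftFrom-∨ a b j []       j≤a = refl
graftFrom-∨ a b j (w ∷ ws) j≤a with ℕ.m≤n⇒m<n∨m≡n j≤a
... | inj₂ refl
  rewrite graftFrom-∨-> a b (suc (leaves a)) ws ℕ.≤-refl
        | ℕ.+-∸-assoc 1 (ℕ.≤-refl {leaves a}) | ℕ.n∸n≡0 (leaves a)
        | ≤⇒≤ᵇ≡true (ℕ.≤-refl {leaves a}) = refl
... | inj₁ j<a
  rewrite graftFrom-∨ a b (suc j) ws j<a | ℕ.+-∸-assoc 1 j<a
        | graft-∨-≤ (graftFrom a (suc j) (take (suc (leaves a ∸ suc j)) ws))
                    (graftFrom b 1 (drop (suc (leaves a ∸ suc j)) ws)) j w
                    (ℕ.≤-trans j≤a (leaves-≤-graftFrom a (suc j) (take (suc (leaves a ∸ suc j)) ws))) = refl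

graftFrom-leaf-beyond : ∀ k ws → graftFrom leaf (suc (suc k)) ws ≡ leaf
graftFrom-leaf-beyond k []       = refl
graftFrom-leaf-beyond k (w ∷ ws) rewrite graftFrom-leaf-beyond (suc k) ws = refl

⊚≡substitute : ∀ t ws → t ⊚ ws ≡ substitute t ws
⊚≡substitute leaf    []       = refl
⊚≡substitute leaf    (w ∷ ws) rewrite graftFrom-leaf-beyond 0 ws = refl
⊚≡substitute (a ∨ b) ws
  rewrite graftFrom-∨ a b 1 ws (0<leaves a) | sym (ℕ.+-∸-assoc 1 (0<leaves a))
  = cong₂ _∨_ (⊚≡substitute a _) (⊚≡substitute b _)

spine : List Tree → Tree
spine []       = leaf
spine (u ∷ us) = u ∨ spine us

substitute-𝟏 : ∀ ts → substitute (𝟏 (suc (length ts))) (ts ++ leaf ∷ []) ≡ spine ts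
substitute-𝟏 []       = refl
substitute-𝟏 (u ∷ us) = cong (u ∨_) (substitute-𝟏 us)

𝟏⊚≡spine : ∀ ts → 𝟏 (suc (length ts)) ⊚ (ts ++ leaf ∷ []) ≡ spine ts
𝟏⊚≡spine ts = trans (⊚≡substitute (𝟏 (suc (length ts))) (ts ++ leaf ∷ [])) (substitute-𝟏 ts)

Markings : List Tree → Set
Markings []       = ⊤
Markings (u ∷ us) = Marking u × Markings us

allMarkings : (us : List Tree) → List (Markings us)
allMarkings []       = tt ∷ []
allMarkings (u ∷ us) = pairs (markings u) (allMarkings us)

signs : (us : List Tree) → Markings us → ℤ
signs []       _        = 1ℤ
signs (u ∷ us) (m , ms) = sign u m * signs us ms

rotateEach : (us : List Tree) → Markings us → List Tree
rotateEach []       _        = []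
rotateEach (u ∷ us) (m , ms) = rotateMarked u m ∷ rotateEach us ms

-- The edges of spine us are those of the right comb 𝟏 (suc (length us)) together with
-- the edges of the trees in us.
spineMarkingʳ : ∀ us → Markingʳ (𝟏 (suc (length us))) → Markings us → Markingʳ (spine us)
spineMarkingʳ []       _               _        = tt
spineMarkingʳ (u ∷ us) (bit , tt , m₀) (m , ms) = bit , m , spineMarkingʳ us m₀ ms

spineMarking : ∀ us → Marking (𝟏 (suc (length us))) → Markings us → Marking (spine us)
spineMarking []       _         _        = tt
spineMarking (u ∷ us) (tt , m₀) (m , ms) = m , spineMarkingʳ us m₀ ms

rotateMarkedʳ-spine : ∀ us g ws m₀ ms → length ws ≡ leaves g →
  rotateMarkedʳ (substitute g ws) (spine us) (spineMarkingʳ us m₀ ms) ≡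
  substitute (rotateMarkedʳ g (𝟏 (suc (length us))) m₀) (ws ++ rotateEach us ms ++ leaf ∷ [])
rotateMarkedʳ-spine []       g ws _ _ ws≡g = sym (substitute-∨ g leaf ws (leaf ∷ []) ws≡g)
rotateMarkedʳ-spine (u ∷ us) g ws (true , tt , m₀) (m , ms) ws≡g = begin
  rotateMarkedʳ (substitute g ws ∨ u′) (spine us) (spineMarkingʳ us m₀ ms)
    ≡⟨ cong (λ x → rotateMarkedʳ x (spine us) (spineMarkingʳ us m₀ ms))
            (sym (substitute-∨ g leaf ws (u′ ∷ []) ws≡g)) ⟩
  rotateMarkedʳ (substitute (g ∨ leaf) (ws ++ u′ ∷ [])) (spine us) (spineMarkingʳ us m₀ ms)
    ≡⟨ rotateMarkedʳ-spine us (g ∨ leaf) (ws ++ u′ ∷ []) m₀ ms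
         (trans (List.length-++ ws) (cong (ℕ._+ 1) ws≡g)) ⟩
  substitute (rotateMarkedʳ (g ∨ leaf) S m₀) ((ws ++ u′ ∷ []) ++ rest)
    ≡⟨ cong (substitute (rotateMarkedʳ (g ∨ leaf) S m₀)) (List.++-assoc ws (u′ ∷ []) rest) ⟩
  substitute (rotateMarkedʳ (g ∨ leaf) S m₀) (ws ++ u′ ∷ rest) ∎
  where
  u′ = rotateMarked u m
  S = 𝟏 (suc (length us))
  rest = rotateEach us ms ++ leaf ∷ []
rotateMarkedʳ-spine (u ∷ us) g ws (false , tt , m₀) (m , ms) ws≡g = begin
  substitute g ws ∨ rotateMarkedʳ (substitute leaf (u′ ∷ [])) (spine us) (spineMarkingʳ us m₀ ms)
    ≡⟨ cong (substitute g ws ∨_) (rotateMarkedʳ-spine us leaf (u′ ∷ []) m₀ ms refl) ⟩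
  substitute g ws ∨ substitute (rotateMarkedʳ leaf S m₀) (u′ ∷ rest)
    ≡⟨ sym (substitute-∨ g (rotateMarkedʳ leaf S m₀) ws (u′ ∷ rest) ws≡g) ⟩
  substitute (g ∨ rotateMarkedʳ leaf S m₀) (ws ++ u′ ∷ rest) ∎
  where
  u′ = rotateMarked u m
  S = 𝟏 (suc (length us))
  rest = rotateEach us ms ++ leaf ∷ []

rotateMarked-spine : ∀ us m₀ ms →
  rotateMarked (spine us) (spineMarking us m₀ ms) ≡ rotateMarked (𝟏 (suc (length us))) m₀ ⊚ (rotateEach us ms ++ leaf ∷ [])
rotateMarked-spine []       _         _        = refl
rotateMarked-spine (u ∷ us) (tt , m₀) (m , ms) =
  trans (rotateMarkedʳ-spine us leaf (rotateMarked u m ∷ []) m₀ ms refl)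
        (sym (⊚≡substitute (rotateMarkedʳ leaf (𝟏 (suc (length us))) m₀) _))

signʳ-spine : ∀ us m₀ ms → signʳ (spine us) (spineMarkingʳ us m₀ ms) ≡ signʳ (𝟏 (suc (length us))) m₀ * signs us ms
signʳ-spine []       _               _        = refl
signʳ-spine (u ∷ us) (bit , tt , m₀) (m , ms) =
  trans (cong (λ x → edgeSign bit * (sign u m * x)) (signʳ-spine us m₀ ms))
        (reorder (edgeSign bit) (sign u m) (signʳ (𝟏 (suc (length us))) m₀) (signs us ms))
  where
  reorder : ∀ e s s₀ ss → e * (s * (s₀ * ss)) ≡ (e * (1ℤ * s₀)) * (s * ss)
  reorder = solve-∀

sign-spine : ∀ us m₀ ms → sign (spine us) (spineMarking us m₀ ms) ≡ sign (𝟏 (suc (length us))) m₀ * signs us ms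
sign-spine []       _         _        = refl
sign-spine (u ∷ us) (tt , m₀) (m , ms) =
  trans (cong (sign u m *_) (signʳ-spine us m₀ ms))
        (reorder (sign u m) (signʳ (𝟏 (suc (length us))) m₀) (signs us ms))
  where
  reorder : ∀ s s₀ ss → s * (s₀ * ss) ≡ (1ℤ * s₀) * (s * ss)
  reorder = solve-∀

∑-markingsʳ-spine : ∀ us (f : Markingʳ (spine us) → ℤ) →
  ∑ (markingsʳ (spine us)) f ≡
  ∑[ m₀ ∈ markingsʳ (𝟏 (suc (length us))) ] ∑[ ms ∈ allMarkings us ] f (spineMarkingʳ us m₀ ms)
∑-markingsʳ-spine []       f = sym (ℤ.+-identityʳ _)
∑-markingsʳ-spine (u ∷ us) f = begin
  ∑ (markingsʳ (u ∨ spine us)) f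
    ≡⟨ ∑-pairs (true ∷ false ∷ []) (markings (u ∨ spine us)) f ⟩
  ∑[ bit ∈ bits ] ∑ (pairs (markings u) (markingsʳ (spine us))) (λ mm → f (bit , mm))
    ≡⟨ ∑-cong bits (λ bit → ∑-pairs (markings u) (markingsʳ (spine us)) (λ mm → f (bit , mm))) ⟩
  ∑[ bit ∈ bits ] ∑[ m ∈ markings u ] ∑[ mC ∈ markingsʳ (spine us) ] f (bit , m , mC)
    ≡⟨ ∑-cong bits (λ bit → ∑-cong (markings u) (λ m → ∑-markingsʳ-spine us (λ mC → f (bit , m , mC)))) ⟩
  ∑[ bit ∈ bits ] ∑[ m ∈ markings u ] ∑[ m₀ ∈ markingsʳ S ] ∑[ ms ∈ allMarkings us ] g bit m₀ (m , ms)
    ≡⟨ ∑-cong bits (λ bit → ∑-comm (markings u) (markingsʳ S)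
                                   (λ m m₀ → ∑[ ms ∈ allMarkings us ] g bit m₀ (m , ms))) ⟩
  ∑[ bit ∈ bits ] ∑[ m₀ ∈ markingsʳ S ] ∑[ m ∈ markings u ] ∑[ ms ∈ allMarkings us ] g bit m₀ (m , ms)
    ≡⟨ ∑-cong bits (λ bit → ∑-cong (markingsʳ S) (λ m₀ → sym (∑-pairs (markings u) (allMarkings us) (g bit m₀)))) ⟩
  ∑[ bit ∈ bits ] ∑[ m₀ ∈ markingsʳ S ] ∑ (allMarkings (u ∷ us)) (g bit m₀)
    ≡⟨ ∑-cong bits (λ bit → sym (trans (∑-pairs (tt ∷ []) (markingsʳ S) (λ mm → ∑ (allMarkings (u ∷ us)) (g′ (bit , mm))))
                                       (ℤ.+-identityʳ (∑[ m₀ ∈ markingsʳ S ] ∑ (allMarkings (u ∷ us)) (g bit m₀)))))  ⟩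
  ∑[ bit ∈ bits ] ∑ (markings (leaf ∨ S)) (λ mm → ∑ (allMarkings (u ∷ us)) (g′ (bit , mm)))
    ≡⟨ sym (∑-pairs bits (markings (leaf ∨ S)) _) ⟩
  ∑[ m₀ ∈ markingsʳ (leaf ∨ S) ] ∑ (allMarkings (u ∷ us)) (g′ m₀) ∎
  where
  bits = true ∷ false ∷ []
  S = 𝟏 (suc (length us))
  g′ : Markingʳ (leaf ∨ S) → Markings (u ∷ us) → ℤ
  g′ m₀ ms = f (spineMarkingʳ (u ∷ us) m₀ ms)
  g : Bool → Markingʳ S → Markings (u ∷ us) → ℤ
  g bit m₀ = g′ (bit , tt , m₀)

∑-markings-spine : ∀ us (f : Marking (spine us) → ℤ) →
  ∑ (markings (spine us)) f ≡
  ∑[ m₀ ∈ markings (𝟏 (suc (length us))) ] ∑[ ms ∈ allMarkings us ] f (spineMarking us m₀ ms)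
∑-markings-spine []       f = sym (ℤ.+-identityʳ _)
∑-markings-spine (u ∷ us) f = begin
  ∑ (pairs (markings u) (markingsʳ (spine us))) f
    ≡⟨ ∑-pairs (markings u) (markingsʳ (spine us)) f ⟩
  ∑[ m ∈ markings u ] ∑[ mC ∈ markingsʳ (spine us) ] f (m , mC)
    ≡⟨ ∑-cong (markings u) (λ m → ∑-markingsʳ-spine us _) ⟩
  ∑[ m ∈ markings u ] ∑[ m₀ ∈ markingsʳ S ] ∑[ ms ∈ allMarkings us ] g m₀ (m , ms)
    ≡⟨ ∑-comm (markings u) (markingsʳ S) _ ⟩
  ∑[ m₀ ∈ markingsʳ S ] ∑[ m ∈ markings u ] ∑[ ms ∈ allMarkings us ] g m₀ (m , ms)
    ≡⟨ ∑-cong (markingsʳ S) (λ m₀ → sym (∑-pairs (markings u) (allMarkings us) (g m₀))) ⟩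
  ∑[ m₀ ∈ markingsʳ S ] ∑ (allMarkings (u ∷ us)) (g m₀)
    ≡⟨ sym (trans (∑-pairs (tt ∷ []) (markingsʳ S) _) (ℤ.+-identityʳ _)) ⟩
  ∑[ m₀ ∈ markings (leaf ∨ S) ] ∑ (allMarkings (u ∷ us)) (f ∘ spineMarking (u ∷ us) m₀) ∎
  where
  S = 𝟏 (suc (length us))
  g : Markingʳ S → Markings (u ∷ us) → ℤ
  g m₀ ms = f (spineMarking (u ∷ us) (tt , m₀) ms)

evalChoices : List (ℤ × List Tree) → (List Tree → ℤ) → ℤ
evalChoices C H = ∑[ p ∈ C ] (proj₁ p * H (proj₂ p))

evalChoices-∷ : ∀ g gs H →
  evalChoices (choices (g ∷ gs)) H ≡ eval g (λ w → evalChoices (choices gs) (λ ws → H (w ∷ ws)))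
evalChoices-∷ g gs H = trans (∑-concatMap _ g _) (∑-cong g (λ p → trans (∑-map _ (choices gs) _)
  (trans (∑-cong (choices gs) (λ q → ℤ.*-assoc (proj₁ p) (proj₁ q) _)) (∑-*ˡ (choices gs) (proj₁ p) _))))

eval-⊚ᴸ : ∀ f gs h → eval (f ⊚ᴸ gs) h ≡ eval f (λ u → evalChoices (choices gs) (λ ws → h (u ⊚ ws)))
eval-⊚ᴸ f gs h = trans (∑-concatMap _ f _) (∑-cong f (λ p → trans (∑-map _ (choices gs) _)
  (trans (∑-cong (choices gs) (λ q → ℤ.*-assoc (proj₁ p) (proj₁ q) _)) (∑-*ˡ (choices gs) (proj₁ p) _))))

evalChoices-≈ : ∀ {gs gs′} → Pointwise _≈_ gs gs′ → ∀ H → evalChoices (choices gs) H ≡ evalChoices (choices gs′) H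
evalChoices-≈ []                                      H = refl
evalChoices-≈ {g ∷ gs} {g′ ∷ gs′} (g≈g′ ∷ gs≈gs′) H = begin
  evalChoices (choices (g ∷ gs)) H                          ≡⟨ evalChoices-∷ g gs H ⟩
  eval g (λ w → evalChoices (choices gs) (λ ws → H (w ∷ ws)))   ≡⟨ eval-cong g (λ w → evalChoices-≈ gs≈gs′ _) ⟩
  eval g (λ w → evalChoices (choices gs′) (λ ws → H (w ∷ ws)))  ≡⟨ eval-≈ g g′ g≈g′ _ ⟩
  eval g′ (λ w → evalChoices (choices gs′) (λ ws → H (w ∷ ws))) ≡⟨ sym (evalChoices-∷ g′ gs′ H) ⟩
  evalChoices (choices (g′ ∷ gs′)) H                        ∎

⊚ᴸ-cong : ∀ f f′ {gs gs′} → f ≈ f′ → Pointwise _≈_ gs gs′ → f ⊚ᴸ gs ≈ f′ ⊚ᴸ gs′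
⊚ᴸ-cong f f′ {gs} {gs′} f≈f′ gs≈gs′ s = begin
  coeff (f ⊚ᴸ gs) s                                                   ≡⟨ coeff≡eval-δ (f ⊚ᴸ gs) s ⟩
  eval (f ⊚ᴸ gs) (λ u → δ u s)                                        ≡⟨ eval-⊚ᴸ f gs _ ⟩
  eval f (λ u → evalChoices (choices gs) (λ ws → δ (u ⊚ ws) s))       ≡⟨ eval-cong f (λ u → evalChoices-≈ gs≈gs′ _) ⟩
  eval f (λ u → evalChoices (choices gs′) (λ ws → δ (u ⊚ ws) s))      ≡⟨ eval-≈ f f′ f≈f′ _ ⟩
  eval f′ (λ u → evalChoices (choices gs′) (λ ws → δ (u ⊚ ws) s))     ≡⟨ sym (eval-⊚ᴸ f′ gs′ _) ⟩
  eval (f′ ⊚ᴸ gs′) (λ u → δ u s)                                      ≡⟨ sym (coeff≡eval-δ (f′ ⊚ᴸ gs′) s) ⟩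
  coeff (f′ ⊚ᴸ gs′) s                                                 ∎

evalChoices-rotationSums : ∀ us H →
  evalChoices (choices (map rotationSum us ++ basis leaf ∷ [])) H ≡
  ∑[ ms ∈ allMarkings us ] (signs us ms * H (rotateEach us ms ++ leaf ∷ []))
evalChoices-rotationSums []       H = refl
evalChoices-rotationSums (u ∷ us) H = begin
  evalChoices (choices (map rotationSum (u ∷ us) ++ basis leaf ∷ [])) H
    ≡⟨ evalChoices-∷ (rotationSum u) (map rotationSum us ++ basis leaf ∷ []) H ⟩
  eval (rotationSum u) (λ w → evalChoices (choices (map rotationSum us ++ basis leaf ∷ [])) (λ ws → H (w ∷ ws)))
    ≡⟨ eval-rotationSum u _ ⟩
  ∑[ m ∈ markings u ] (sign u m * evalChoices (choices (map rotationSum us ++ basis leaf ∷ []))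
                                              (λ ws → H (rotateMarked u m ∷ ws)))
    ≡⟨ ∑-cong (markings u) (λ m → cong (sign u m *_) (evalChoices-rotationSums us (λ ws → H (rotateMarked u m ∷ ws)))) ⟩
  ∑[ m ∈ markings u ] (sign u m * ∑[ ms ∈ allMarkings us ] (signs us ms * H′ (m , ms)))
    ≡⟨ ∑-cong (markings u) (λ m → trans (sym (∑-*ˡ (allMarkings us) (sign u m) _))
                                        (∑-cong (allMarkings us) (λ ms → sym (ℤ.*-assoc (sign u m) _ _)))) ⟩
  ∑[ m ∈ markings u ] ∑[ ms ∈ allMarkings us ] (signs (u ∷ us) (m , ms) * H′ (m , ms))
    ≡⟨ sym (∑-pairs (markings u) (allMarkings us) _) ⟩
  ∑[ ms ∈ allMarkings (u ∷ us) ] (signs (u ∷ us) ms * H′ ms) ∎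
  where
  H′ : Markings (u ∷ us) → ℤ
  H′ ms = H (rotateEach (u ∷ us) ms ++ leaf ∷ [])

eval-rotationSum-spine : ∀ ts h → eval (rotationSum (spine ts)) h ≡
  eval (rotationSum (𝟏 (suc (length ts))) ⊚ᴸ (map rotationSum ts ++ basis leaf ∷ [])) h
eval-rotationSum-spine ts h = begin
  eval (rotationSum (spine ts)) h
    ≡⟨ eval-rotationSum (spine ts) h ⟩
  ∑[ m ∈ markings (spine ts) ] (sign (spine ts) m * h (rotateMarked (spine ts) m))
    ≡⟨ ∑-markings-spine ts _ ⟩
  ∑[ m₀ ∈ markings R ] ∑[ ms ∈ allMarkings ts ]
    (sign (spine ts) (spineMarking ts m₀ ms) * h (rotateMarked (spine ts) (spineMarking ts m₀ ms)))
    ≡⟨ ∑-cong (markings R) (λ m₀ → ∑-cong (allMarkings ts) (λ ms →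
         cong₂ (λ x y → x * h y) (sign-spine ts m₀ ms) (rotateMarked-spine ts m₀ ms))) ⟩
  ∑[ m₀ ∈ markings R ] ∑[ ms ∈ allMarkings ts ] ((sign R m₀ * signs ts ms) * grafted m₀ ms)
    ≡⟨ ∑-cong (markings R) (λ m₀ → trans (∑-cong (allMarkings ts) (λ ms → ℤ.*-assoc (sign R m₀) _ _))
                                         (∑-*ˡ (allMarkings ts) (sign R m₀) _)) ⟩
  ∑[ m₀ ∈ markings R ] (sign R m₀ * ∑[ ms ∈ allMarkings ts ] (signs ts ms * grafted m₀ ms))
    ≡⟨ ∑-cong (markings R) (λ m₀ → cong (sign R m₀ *_)
         (sym (evalChoices-rotationSums ts (λ ws → h (rotateMarked R m₀ ⊚ ws))))) ⟩
  ∑[ m₀ ∈ markings R ] (sign R m₀ * evalChoices (choices gs) (λ ws → h (rotateMarked R m₀ ⊚ ws)))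
    ≡⟨ sym (eval-rotationSum R _) ⟩
  eval (rotationSum R) (λ u → evalChoices (choices gs) (λ ws → h (u ⊚ ws)))
    ≡⟨ sym (eval-⊚ᴸ (rotationSum R) gs h) ⟩
  eval (rotationSum R ⊚ᴸ gs) h ∎
  where
  R  = 𝟏 (suc (length ts))
  gs = map rotationSum ts ++ basis leaf ∷ []
  grafted : Marking R → Markings ts → ℤ
  grafted m₀ ms = h (rotateMarked R m₀ ⊚ (rotateEach ts ms ++ leaf ∷ []))

rotationSum-spine : ∀ ts →
  rotationSum (spine ts) ≈ rotationSum (𝟏 (suc (length ts))) ⊚ᴸ (map rotationSum ts ++ basis leaf ∷ [])
rotationSum-spine ts s = begin
  coeff (rotationSum (spine ts)) s             ≡⟨ coeff≡eval-δ (rotationSum (spine ts)) s ⟩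
  eval (rotationSum (spine ts)) (λ u → δ u s)  ≡⟨ eval-rotationSum-spine ts (λ u → δ u s) ⟩
  eval grafted (λ u → δ u s)                   ≡⟨ sym (coeff≡eval-δ grafted s) ⟩
  coeff grafted s                              ∎
  where grafted = rotationSum (𝟏 (suc (length ts))) ⊚ᴸ (map rotationSum ts ++ basis leaf ∷ [])

proposition2p23 : (D : TamariMöbius) (n r : ℕ) (t : Tree) (ts : List Tree) →
    leaves t ≡ n → suc (length ts) ≡ r → r < n →
    t ≡ 𝟏 r ⊚ (ts ++ leaf ∷ []) →
    TamariMöbius.M D t ≈ (TamariMöbius.M D (𝟏 r) ⊚ᴸ (map (TamariMöbius.M D) ts ++ basis leaf ∷ []))
proposition2p23 D n .(suc (length ts)) t ts _ refl _ t≡𝟏⊚ts s = begin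
  coeff (M t) s                      ≡⟨ M≈rotationSum t s ⟩
  coeff (rotationSum t) s            ≡⟨ cong (λ x → coeff (rotationSum x) s) (trans t≡𝟏⊚ts (𝟏⊚≡spine ts)) ⟩
  coeff (rotationSum (spine ts)) s   ≡⟨ rotationSum-spine ts s ⟩
  coeff (rotationSum R ⊚ᴸ (map rotationSum ts ++ basis leaf ∷ [])) s
                                     ≡⟨ sym (⊚ᴸ-cong (M R) (rotationSum R) (M≈rotationSum R) M≈rotationSum* s) ⟩
  coeff (M R ⊚ᴸ (map M ts ++ basis leaf ∷ [])) s ∎
  where
  open TamariMöbius D
  open Möbius D
  R = 𝟏 (suc (length ts))
  M≈rotationSum* : Pointwise _≈_ (map M ts ++ basis leaf ∷ []) (map rotationSum ts ++ basis leaf ∷ [])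
  M≈rotationSum* = Pointwise.++⁺ (Pointwise.map⁺ M rotationSum (Pointwise.refl (M≈rotationSum _))) ((λ _ → refl) ∷ [])
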